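{- Let $\mathcal B$ be a pre-matroid on a finite set $X$ and let $\omega,\pi,a,z,\varepsilon$ be as in the context. If $B\in\mathcal B$ is a branching image, then $\varepsilon(B)\in\mathcal B$ and $\varepsilon(B)$ is a branching image. Moreover, $\varepsilon(B)\ne B$ and $B$ contains exactly one of the elements $a,z$.
   Context: A pre-matroid on a finite set $X$ is a non-empty set $\mathcal B$ of subsets of $X$ (bases). For $Y\subseteq X$, $x\notin Y$, $Y+x=Y\cup\{x\}$; for $y\in Y$, $Y-y=Y\setminus\{y\}$. An almost-basis is $B-x$ with $B\in\mathcal B$, $x\in B$; $U(D)=\{x\notin D: D+x\in\mathcal B\}$. For a linear order $\rho$ on $X$ and an almost-basis $D$, $\varphi_\rho(D)=D+\min_\rho U(D)$. Let $\omega$ be a linear order on $X$, $a\ne z$ consecutive for $\omega$ with $a<_\omega z$, $\varepsilon$ the transposition exchanging $a,z$ (acting on subsets elementwise), and $\pi$ the linear order agreeing with $\omega$ except $z<_\pi a$. An almost-basis $A$ is branching if $\varphi_\omega(A)\ne\varphi_\pi(A)$. A basis $B$ is a branching image if $B=\varphi_\omega(A)$ or $B=\varphi_\pi(A)$ for some branching almost-basis $A$. -}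

module Defs where

open import Data.Nat using (ℕ)
open import Data.Fin using (Fin)
open import Data.Fin.Subset using (Subset; _∈_; _∉_; _∪_; _-_; ⁅_⁆)
open import Data.Fin.Permutation.Components using (transpose)
open import Data.Vec using (tabulate; lookup)
open import Data.Product using (Σ; ∃; ∃-syntax; _×_; _,_)
open import Data.Sum using (_⊎_)
open import Relation.Binary using (Rel)
open import Level using (0ℓ)
open import Relation.Binary.PropositionalEquality using (_≡_; _≢_)
open import Relation.Nullary using (¬_)

-- The finite ground set X is Fin n.  A set of subsets of X is a predicate on Subset n.
Family : ℕ → Set₁
Family n = Subset n → Set

IsPreMatroid : {n : ℕ} → Family n → Set
IsPreMatroid ℬ = ∃[ B ] ℬ B

_+ₛ_ : {n : ℕ} → Subset n → Fin n → Subset n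
Y +ₛ x = Y ∪ ⁅ x ⁆

AlmostBasis : {n : ℕ} → Family n → Subset n → Set
AlmostBasis ℬ D = ∃[ B ] ∃[ x ] (ℬ B × x ∈ B × D ≡ B - x)

InU : {n : ℕ} → Family n → Subset n → Fin n → Set
InU ℬ D x = x ∉ D × ℬ (D +ₛ x)

IsMinU : {n : ℕ} → Family n → Rel (Fin n) 0ℓ → Subset n → Fin n → Set
IsMinU ℬ _<ρ_ D x = InU ℬ D x × (∀ y → InU ℬ D y → y ≢ x → x <ρ y)

Phi : {n : ℕ} → Family n → Rel (Fin n) 0ℓ → Subset n → Subset n → Set
Phi ℬ ρ D B = ∃[ x ] (IsMinU ℬ ρ D x × B ≡ D +ₛ x)

swapOrder : {n : ℕ} → Rel (Fin n) 0ℓ → Fin n → Fin n → Rel (Fin n) 0ℓ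
swapOrder _<ω_ a z x y = (x ≡ z × y ≡ a) ⊎ (x <ω y × ¬ (x ≡ a × y ≡ z))

Consecutive : {n : ℕ} → Rel (Fin n) 0ℓ → Fin n → Fin n → Set
Consecutive _<ω_ a z = a <ω z × (∀ c → ¬ (a <ω c × c <ω z))

-- ε acting elementwise on subsets: ε(B) = { ε(x) : x ∈ B }, so y ∈ ε(B) iff ε(y) ∈ B
εₛ : {n : ℕ} → Fin n → Fin n → Subset n → Subset n
εₛ a z B = tabulate (λ y → lookup B (transpose a z y))

Branching : {n : ℕ} → Family n → Rel (Fin n) 0ℓ → Rel (Fin n) 0ℓ → Subset n → Set
Branching ℬ ω π A =
  AlmostBasis ℬ A × ∃[ B₁ ] ∃[ B₂ ] (Phi ℬ ω A B₁ × Phi ℬ π A B₂ × B₁ ≢ B₂)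

BranchingImage : {n : ℕ} → Family n → Rel (Fin n) 0ℓ → Rel (Fin n) 0ℓ → Subset n → Set
BranchingImage ℬ ω π B = ∃[ A ] (Branching ℬ ω π A × (Phi ℬ ω A B ⊎ Phi ℬ π A B))

-- Since π differs from ω only on the pair a, z, the ω- and π-minima of U(A) can differ
-- for an almost-basis A only if they are a and z respectively, both outside A.  So the
-- branching images of A are A + a and A + z, and ε, which fixes A, exchanges them.

module Submission where

open import Defs
open import Data.Nat using (ℕ)
open import Data.Fin using (Fin; zero; suc; _≟_)
open import Data.Fin.Subset using (Subset; _∈_; _∉_; ⁅_⁆; _∪_)
open import Data.Fin.Subset.Properties using (x∈⁅x⁆; x∈⁅y⁆⇒x≡y; x∈p∪q⁺; x∈p∪q⁻)
open import Data.Fin.Permutation.Components using (transpose; transpose-inverse)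
open import Data.Bool using (true; false; _∨_)
open import Data.Vec using (lookup)
open import Data.Vec.Properties
  using (lookup-zipWith; lookup-replicate; lookup∘tabulate; tabulate∘lookup; tabulate-cong; lookup⇒[]=)
open import Data.Product using (_×_; _,_; proj₁; proj₂; ∃-syntax)
open import Data.Sum using (_⊎_; inj₁; inj₂)
open import Data.Empty using (⊥-elim)
open import Function using (_∘_; _⇔_; mk⇔)
open import Level using (0ℓ)
open import Relation.Binary using (Rel; IsStrictTotalOrder)
open import Relation.Binary.Definitions using (Asymmetric)
open import Relation.Binary.PropositionalEquality
  using (_≡_; _≢_; refl; sym; trans; cong; cong₂; subst; module ≡-Reasoning)
open import Relation.Nullary using (does; yes; no)
open import Relation.Nullary.Decidable using (dec-true; dec-false; does-⇔)

transpose-comm : ∀ {n} (i j k : Fin n) → transpose i j k ≡ transpose j i k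
transpose-comm i j k with k ≟ i | k ≟ j
... | yes refl | yes refl = refl
... | yes refl | no _     rewrite dec-true (k ≟ k) refl = refl
... | no _     | yes refl rewrite dec-true (k ≟ k) refl = refl
... | no k≢i   | no k≢j   rewrite dec-false (k ≟ i) k≢i | dec-false (k ≟ j) k≢j = refl

transpose-involutive : ∀ {n} (i j k : Fin n) → transpose i j (transpose i j k) ≡ k
transpose-involutive i j k = trans (cong (transpose i j) (transpose-comm i j k)) (transpose-inverse i j)

transpose-≡⇔ : ∀ {n} (i j : Fin n) {k l : Fin n} → transpose i j k ≡ l ⇔ k ≡ transpose i j l
transpose-≡⇔ i j {k} {l} = mk⇔ (λ { refl → sym (transpose-involutive i j k) })
                               (λ { refl → transpose-involutive i j l })

transpose-matchˡ : ∀ {n} (i j : Fin n) → transpose i j i ≡ j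
transpose-matchˡ i j rewrite dec-true (i ≟ i) refl = refl

transpose-matchʳ : ∀ {n} (i j : Fin n) → transpose i j j ≡ i
transpose-matchʳ i j = trans (transpose-comm i j j) (transpose-matchˡ j i)

lookup-⁅⁆ : ∀ {n} (x y : Fin n) → lookup ⁅ x ⁆ y ≡ does (y ≟ x)
lookup-⁅⁆ zero    zero    = refl
lookup-⁅⁆ zero    (suc y) = lookup-replicate y false
lookup-⁅⁆ (suc x) zero    = refl
lookup-⁅⁆ (suc x) (suc y) with y ≟ x | lookup-⁅⁆ x y
... | yes _ | eq = eq
... | no _  | eq = eq

∉⇒lookup≡false : ∀ {n} {p : Subset n} {x : Fin n} → x ∉ p → lookup p x ≡ false
∉⇒lookup≡false {p = p} {x} x∉p with lookup p x in eq
... | true  = ⊥-elim (x∉p (lookup⇒[]= x p eq))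
... | false = refl

x∈p+ₛx : ∀ {n} (p : Subset n) (x : Fin n) → x ∈ p +ₛ x
x∈p+ₛx p x = x∈p∪q⁺ (inj₂ (x∈⁅x⁆ x))

y∉p+ₛx : ∀ {n} {p : Subset n} {x y : Fin n} → y ≢ x → y ∉ p → y ∉ p +ₛ x
y∉p+ₛx {p = p} y≢x y∉p y∈p+x with x∈p∪q⁻ p _ y∈p+x
... | inj₁ y∈p  = y∉p y∈p
... | inj₂ y∈⁅x⁆ = y≢x (x∈⁅y⁆⇒x≡y _ y∈⁅x⁆)

+ₛ-cancelˡ : ∀ {n} {p : Subset n} {x y : Fin n} → x ∉ p → p +ₛ x ≡ p +ₛ y → x ≡ y
+ₛ-cancelˡ {p = p} {x} {y} x∉p eq with x∈p∪q⁻ p _ (subst (x ∈_) eq (x∈p+ₛx p x))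
... | inj₁ x∈p  = ⊥-elim (x∉p x∈p)
... | inj₂ x∈⁅y⁆ = x∈⁅y⁆⇒x≡y y x∈⁅y⁆

module _ {n : ℕ} (a z : Fin n) where

  private
    τ : Fin n → Fin n
    τ = transpose a z

  lookup-εₛ : ∀ (p : Subset n) y → lookup (εₛ a z p) y ≡ lookup p (τ y)
  lookup-εₛ p = lookup∘tabulate (λ y → lookup p (τ y))

  εₛ-ext : ∀ (p q : Subset n) → (∀ y → lookup p (τ y) ≡ lookup q y) → εₛ a z p ≡ q
  εₛ-ext p q eq = trans (tabulate-cong eq) (tabulate∘lookup q)

  εₛ-∪ : ∀ (p q : Subset n) → εₛ a z (p ∪ q) ≡ εₛ a z p ∪ εₛ a z q
  εₛ-∪ p q = εₛ-ext (p ∪ q) (εₛ a z p ∪ εₛ a z q) λ y → begin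
    lookup (p ∪ q) (τ y)                        ≡⟨ lookup-zipWith _∨_ (τ y) p q ⟩
    lookup p (τ y) ∨ lookup q (τ y)             ≡⟨ sym (cong₂ _∨_ (lookup-εₛ p y) (lookup-εₛ q y)) ⟩
    lookup (εₛ a z p) y ∨ lookup (εₛ a z q) y   ≡⟨ sym (lookup-zipWith _∨_ y (εₛ a z p) (εₛ a z q)) ⟩
    lookup (εₛ a z p ∪ εₛ a z q) y              ∎
    where open ≡-Reasoning

  εₛ-⁅⁆ : ∀ (x : Fin n) → εₛ a z ⁅ x ⁆ ≡ ⁅ τ x ⁆
  εₛ-⁅⁆ x = εₛ-ext ⁅ x ⁆ ⁅ τ x ⁆ λ y → begin
    lookup ⁅ x ⁆ (τ y)   ≡⟨ lookup-⁅⁆ x (τ y) ⟩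
    does (τ y ≟ x)       ≡⟨ does-⇔ (transpose-≡⇔ a z) (τ y ≟ x) (y ≟ τ x) ⟩
    does (y ≟ τ x)       ≡⟨ sym (lookup-⁅⁆ (τ x) y) ⟩
    lookup ⁅ τ x ⁆ y     ∎
    where open ≡-Reasoning

  εₛ-fixes : ∀ {p : Subset n} → a ∉ p → z ∉ p → εₛ a z p ≡ p
  εₛ-fixes {p} a∉p z∉p = εₛ-ext p p fix
    where
    fix : ∀ y → lookup p (τ y) ≡ lookup p y
    fix y with y ≟ a
    ... | yes refl = trans (∉⇒lookup≡false z∉p) (sym (∉⇒lookup≡false a∉p))
    ... | no _ with y ≟ z
    ...   | yes refl = trans (∉⇒lookup≡false a∉p) (sym (∉⇒lookup≡false z∉p))
    ...   | no _     = refl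

  εₛ-+ₛ : ∀ {p : Subset n} (x : Fin n) → a ∉ p → z ∉ p → εₛ a z (p +ₛ x) ≡ p +ₛ τ x
  εₛ-+ₛ {p} x a∉p z∉p = begin
    εₛ a z (p ∪ ⁅ x ⁆)        ≡⟨ εₛ-∪ p ⁅ x ⁆ ⟩
    εₛ a z p ∪ εₛ a z ⁅ x ⁆   ≡⟨ cong₂ _∪_ (εₛ-fixes a∉p z∉p) (εₛ-⁅⁆ x) ⟩
    p ∪ ⁅ τ x ⁆               ∎
    where open ≡-Reasoning

module _ {n : ℕ} (ℬ : Family n) {_<_ : Rel (Fin n) 0ℓ} (<-asym : Asymmetric _<_) where

  IsMinU-unique : ∀ {D x y} → IsMinU ℬ _<_ D x → IsMinU ℬ _<_ D y → x ≡ y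
  IsMinU-unique {x = x} {y} (x∈U , x-min) (y∈U , y-min) with x ≟ y
  ... | yes x≡y = x≡y
  ... | no x≢y  = ⊥-elim (<-asym (x-min y y∈U (x≢y ∘ sym)) (y-min x x∈U x≢y))

  Phi-unique : ∀ {D B x} → Phi ℬ _<_ D B → IsMinU ℬ _<_ D x → B ≡ D +ₛ x
  Phi-unique {D} (y , y-min , refl) x-min = cong (D +ₛ_) (IsMinU-unique y-min x-min)

swapOrder-asym : ∀ {n} {_<ω_ : Rel (Fin n) 0ℓ} {a z : Fin n} →
                 a ≢ z → Asymmetric _<ω_ → Asymmetric (swapOrder _<ω_ a z)
swapOrder-asym a≢z <ω-asym (inj₁ (refl , refl)) (inj₁ (a≡z , _))  = a≢z a≡z
swapOrder-asym a≢z <ω-asym (inj₁ (refl , refl)) (inj₂ (_ , ¬az))  = ¬az (refl , refl)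
swapOrder-asym a≢z <ω-asym (inj₂ (_ , ¬az)) (inj₁ (refl , refl))  = ¬az (refl , refl)
swapOrder-asym a≢z <ω-asym (inj₂ (x<y , _)) (inj₂ (y<x , _))      = <ω-asym x<y y<x

module BranchingTransposition {n : ℕ} (ℬ : Family n) (_<ω_ : Rel (Fin n) 0ℓ)
                              (<ω-asym : Asymmetric _<ω_) {a z : Fin n} (a≢z : a ≢ z) where

  π : Rel (Fin n) 0ℓ
  π = swapOrder _<ω_ a z

  branching-minima : ∀ {A} → Branching ℬ _<ω_ π A → IsMinU ℬ _<ω_ A a × IsMinU ℬ π A z
  branching-minima (_ , _ , _ , (x₁ , min₁ , refl) , (x₂ , min₂ , refl) , B₁≢B₂) with x₁ ≟ x₂
  ... | yes refl = ⊥-elim (B₁≢B₂ refl)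
  ... | no x₁≢x₂ with proj₂ min₂ x₁ (proj₁ min₁) x₁≢x₂
  ...   | inj₁ (refl , refl) = min₁ , min₂
  ...   | inj₂ (x₂<x₁ , _)   = ⊥-elim (<ω-asym x₂<x₁ (proj₂ min₁ x₂ (proj₁ min₂) (x₁≢x₂ ∘ sym)))

  branching-image-cases : ∀ {B} → BranchingImage ℬ _<ω_ π B →
                          ∃[ A ] (Branching ℬ _<ω_ π A × (B ≡ A +ₛ a ⊎ B ≡ A +ₛ z))
  branching-image-cases (A , br , inj₁ φω) =
    A , br , inj₁ (Phi-unique ℬ <ω-asym φω (proj₁ (branching-minima br)))
  branching-image-cases (A , br , inj₂ φπ) =
    A , br , inj₂ (Phi-unique ℬ (swapOrder-asym a≢z <ω-asym) φπ (proj₂ (branching-minima br)))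

  Conclusion : Subset n → Set
  Conclusion B = ℬ (εₛ a z B) × BranchingImage ℬ _<ω_ π (εₛ a z B) × εₛ a z B ≢ B
               × ((a ∈ B × z ∉ B) ⊎ (a ∉ B × z ∈ B))

  ω-image-conclusion : ∀ {A} → Branching ℬ _<ω_ π A → Conclusion (A +ₛ a)
  ω-image-conclusion {A} br with branching-minima br
  ... | ((a∉A , _) , _) , minπ@((z∉A , ℬ[A+z]) , _) =
      subst ℬ (sym ε[A+a]) ℬ[A+z]
    , (A , br , inj₂ (z , minπ , ε[A+a]))
    , (λ ε≡ → a≢z (+ₛ-cancelˡ a∉A (trans (sym ε≡) ε[A+a])))
    , inj₁ (x∈p+ₛx A a , y∉p+ₛx (a≢z ∘ sym) z∉A)
    where
    ε[A+a] : εₛ a z (A +ₛ a) ≡ A +ₛ z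
    ε[A+a] = trans (εₛ-+ₛ a z a a∉A z∉A) (cong (A +ₛ_) (transpose-matchˡ a z))

  π-image-conclusion : ∀ {A} → Branching ℬ _<ω_ π A → Conclusion (A +ₛ z)
  π-image-conclusion {A} br with branching-minima br
  ... | minω@((a∉A , ℬ[A+a]) , _) , ((z∉A , _) , _) =
      subst ℬ (sym ε[A+z]) ℬ[A+a]
    , (A , br , inj₁ (a , minω , ε[A+z]))
    , (λ ε≡ → a≢z (sym (+ₛ-cancelˡ z∉A (trans (sym ε≡) ε[A+z]))))
    , inj₂ (y∉p+ₛx a≢z a∉A , x∈p+ₛx A z)
    where
    ε[A+z] : εₛ a z (A +ₛ z) ≡ A +ₛ a
    ε[A+z] = trans (εₛ-+ₛ a z z a∉A z∉A) (cong (A +ₛ_) (transpose-matchʳ a z))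

lemma8p5 : (n : ℕ) (ℬ : Family n) → IsPreMatroid ℬ →
           (_<ω_ : Rel (Fin n) 0ℓ) → IsStrictTotalOrder _≡_ _<ω_ →
           (a z : Fin n) → a ≢ z → Consecutive _<ω_ a z →
           (B : Subset n) → ℬ B →
           BranchingImage ℬ _<ω_ (swapOrder _<ω_ a z) B →
           ℬ (εₛ a z B)
           × BranchingImage ℬ _<ω_ (swapOrder _<ω_ a z) (εₛ a z B)
           × εₛ a z B ≢ B
           × ((a ∈ B × z ∉ B) ⊎ (a ∉ B × z ∈ B))
lemma8p5 n ℬ _ _<ω_ sto a z a≢z _ B _ image = conclusion (branching-image-cases image)
  where
  open BranchingTransposition ℬ _<ω_ (IsStrictTotalOrder.asym sto) a≢z
  conclusion : ∃[ A ] (Branching ℬ _<ω_ π A × (B ≡ A +ₛ a ⊎ B ≡ A +ₛ z)) → Conclusion B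
  conclusion (A , br , inj₁ B≡A+a) = subst Conclusion (sym B≡A+a) (ω-image-conclusion br)
  conclusion (A , br , inj₂ B≡A+z) = subst Conclusion (sym B≡A+z) (π-image-conclusion br)
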